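{- (Provable in $\mathsf{RCA}_0$.) If a coloring $f:\operatorname{FIN}_A\to C$ is uniformly recurrent, then it is recurrent.
   Context: $A$ finite nonempty alphabet, $C$ finite nonempty color set, $\star\notin A$. A located word is a function from a finite subset of $\mathbb{N}$ into $A$; here the empty located word $\emptyset$ is included ($\emptyset\cup p=p$), and $\operatorname{FIN}_A$ is the set of located words. A located variable word is a function from a finite nonempty subset of $\mathbb{N}$ into $A\cup\{\star\}$ taking value $\star$ at least once; for $a\in A$, $p[a]$ replaces each $\star$ by $a$. $p\cup q$ is the union of functions when $\max\operatorname{dom}p<\min\operatorname{dom}q$. $\operatorname{FIN}_A(m,n)$ (resp. $\operatorname{FIN}_{A\star}(m,n)$), $n\in\mathbb{N}\cup\{\infty\}$, is the set of located (resp. located variable) words with domain contained in $[m,n)$. For $p\in\operatorname{FIN}_A(\ell,\infty)$, $S^\ell_p(f):\operatorname{FIN}_A(0,\ell)\to C$, $S^\ell_p(f)(q)=f(q\cup p)$; $S^\ell(f)=S^\ell_\emptyset(f)$. $f$ is recurrent if for every $\ell$ there is $p\in\operatorname{FIN}_{A\star}(\ell,\infty)$ with $S^\ell_{p[a]}(f)=S^\ell(f)$ for every $a\in A$. $f$ is uniformly recurrent if for every $\ell$ there is $m>\ell$ such that for every $p\in\operatorname{FIN}_A(m,\infty)$ there is $q\in\operatorname{FIN}_A(\ell,m)$ with $S^\ell(f)=S^\ell_{q\cup p}(f)$. -}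

module Defs where

open import Data.Nat using (ℕ; _≤_; _<_)
open import Data.Fin using (Fin)
open import Data.Maybe using (Maybe; just; nothing)
open import Data.Product using (_×_; _,_; proj₁; Σ; ∃)
open import Data.List using (List; _++_; map)
open import Data.List.Relation.Unary.All using (All)
open import Data.List.Relation.Unary.Any using (Any)
open import Data.List.Relation.Unary.Linked using (Linked)
open import Relation.Binary.PropositionalEquality using (_≡_)

-- Alphabet A = Fin (suc k) (finite, nonempty); colors C = Fin (suc c).
-- A located word over letters B is encoded as the list of its graph
-- (position , letter), listed in strictly increasing order of positions.
Located : Set → Set
Located B = List (ℕ × B)

-- well-formedness: strictly increasing positions (so the list is the graph
-- of a function from a finite subset of ℕ, each such function having
-- exactly one encoding)
Increasing : {B : Set} → Located B → Set
Increasing = Linked (λ x y → proj₁ x < proj₁ y)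

InRange : {B : Set} → ℕ → ℕ → Located B → Set
InRange m n = All (λ x → m ≤ proj₁ x × proj₁ x < n)

InRangeInf : {B : Set} → ℕ → Located B → Set
InRangeInf m = All (λ x → m ≤ proj₁ x)

Word : ℕ → Set
Word k = Located (Fin k)

-- located variable words: letters in A ∪ {⋆}, ⋆ encoded as nothing
VarWord : ℕ → Set
VarWord k = Located (Maybe (Fin k))

HasStar : {k : ℕ} → VarWord k → Set
HasStar = Any (λ x → Data.Product.proj₂ x ≡ nothing)

fillLetter : {k : ℕ} → Fin k → Maybe (Fin k) → Fin k
fillLetter a (just b) = b
fillLetter a nothing  = a

subst⋆ : {k : ℕ} → VarWord k → Fin k → Word k
subst⋆ p a = map (λ x → proj₁ x , fillLetter a (Data.Product.proj₂ x)) p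

-- A coloring f : FIN_A → C is a function on encodings; its values on
-- non-well-formed lists are never used below.
-- For q in [0,ℓ) and p in [ℓ,∞), q ∪ p is encoded by q ++ p.
SameShift : {k c : ℕ} → (Word k → Fin c) → ℕ → Word k → Set
SameShift {k} f ℓ p =
  (q : Word k) → Increasing q → InRange 0 ℓ q → f (q ++ p) ≡ f q

Recurrent : {k c : ℕ} → (Word k → Fin c) → Set
Recurrent {k} f = (ℓ : ℕ) → Σ (VarWord k) λ p →
  Increasing p × HasStar p × InRangeInf ℓ p ×
  ((a : Fin k) → SameShift f ℓ (subst⋆ p a))

UniformlyRecurrent : {k c : ℕ} → (Word k → Fin c) → Set
UniformlyRecurrent {k} f = (ℓ : ℕ) → Σ ℕ λ m → ℓ < m ×
  ((p : Word k) → Increasing p → InRangeInf m p →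
    Σ (Word k) λ q → Increasing q × InRange ℓ m q × SameShift f ℓ (q ++ p))

{-# OPTIONS --safe #-}
module Submission where

-- Uniform recurrence at ℓ yields m such that every word u placed on [m , m + n) returns to
-- S^ℓ f through some word q(u) ⊆ [ℓ , m). There are only finitely many such q, so by the
-- Hales–Jewett theorem q(v[a]) = q is the same for all points of some combinatorial line v,
-- and the variable word q ∪ v witnesses recurrence at ℓ. Hales–Jewett itself is proved by
-- colour focusing, by induction on the alphabet.

open import Data.Nat using (ℕ; zero; suc; _+_; _<_; _≤_; z≤n; s≤s; _<?_; _≟_; pred)
open import Data.Nat.Properties
  using (n<1+n; <-trans; <-≤-trans; ≤-trans; ≤-refl; ≤-reflexive; <⇒≤; m≤n⇒m≤1+n; ≤⇒≯; ≤∧≢⇒<;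
         +-suc; +-identityʳ)
open import Data.Fin using (Fin; zero; suc; toℕ; fromℕ<)
open import Data.Fin.Properties using (pigeonhole; toℕ-fromℕ<; toℕ≤pred[n])
open import Data.Maybe using (Maybe; just; nothing; maybe; fromMaybe)
open import Data.Sum using (_⊎_; inj₁; inj₂; [_,_]′)
import Data.Sum as Sum
open import Data.Product using (Σ; ∃; ∃₂; _×_; _,_; proj₁; proj₂; map₂)
open import Data.List as List using (List; []; _∷_; length; cartesianProductWith; allFin)
import Data.List.Properties as List
open import Data.List.Membership.Propositional using (_∈_)
open import Data.List.Membership.Propositional.Properties using (∈-cartesianProductWith⁺; ∈-allFin)
open import Data.List.Relation.Unary.Any as Any using (here; there)
open import Data.List.Relation.Unary.Any.Properties using (lookup-index)
import Data.List.Relation.Unary.Any.Properties as Any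
open import Data.List.Relation.Unary.All as All using (All; []; _∷_)
import Data.List.Relation.Unary.All.Properties as All
open import Data.List.Relation.Unary.Linked using ([]; [-]; _∷_)
import Data.List.Relation.Unary.Linked.Properties as Linked
open import Data.Vec as Vec using (Vec; []; _∷_; _++_)
import Data.Vec.Properties as Vec
open import Data.Vec.Relation.Unary.All as VecAll using ([]; _∷_)
import Data.Vec.Relation.Unary.All.Properties as VecAll
open import Data.Vec.Relation.Unary.Any using (here; there)
open import Data.Vec.Membership.Propositional using () renaming (_∈_ to _∈ᵥ_)
open import Data.Vec.Membership.Propositional.Properties using (∈-map⁺; ∈-++⁺ˡ; ∈-++⁺ʳ)
open import Data.Empty using (⊥-elim)
open import Function using (id; _∘_; const)
open import Relation.Nullary using (yes; no; contradiction)
open import Relation.Binary.PropositionalEquality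
  using (_≡_; refl; sym; trans; cong; cong₂; subst; module ≡-Reasoning)
open ≡-Reasoning

open import Defs

vectors : {A : Set} (n : ℕ) → List A → List (Vec A n)
vectors zero    xs = [] ∷ []
vectors (suc n) xs = cartesianProductWith _∷_ xs (vectors n xs)

∈-vectors : {A : Set} {xs : List A} {n : ℕ} {u : Vec A n} → VecAll.All (_∈ xs) u → u ∈ vectors n xs
∈-vectors []           = here refl
∈-vectors (x∈ ∷ u∈) = ∈-cartesianProductWith⁺ _∷_ x∈ (∈-vectors u∈)

∈-pigeonhole : {C : Set} (cs : List C) (g : Fin (suc (length cs)) → C) → (∀ k → g k ∈ cs) →
  ∃₂ λ k k' → toℕ k < toℕ k' × g k ≡ g k'
∈-pigeonhole cs g g∈cs with pigeonhole (n<1+n (length cs)) (Any.index ∘ g∈cs)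
... | k , k' , k<k' , same-index = k , k' , k<k' , (begin
  g k                                  ≡⟨ lookup-index (g∈cs k) ⟩
  List.lookup cs (Any.index (g∈cs k))  ≡⟨ cong (List.lookup cs) same-index ⟩
  List.lookup cs (Any.index (g∈cs k')) ≡⟨ lookup-index (g∈cs k') ⟨
  g k'                                 ∎)

cut : {A : Set} → ℕ → A → A → ℕ → A
cut i x y n with n <? i
... | yes _ = x
... | no  _ = y

cut-< : {A : Set} {i n : ℕ} {x y : A} → n < i → cut i x y n ≡ x
cut-< {i = i} {n} n<i with n <? i
... | yes _   = refl
... | no  n≮i = contradiction n<i n≮i

cut-≥ : {A : Set} {i n : ℕ} {x y : A} → i ≤ n → cut i x y n ≡ y
cut-≥ {i = i} {n} i≤n with n <? i
... | yes n<i = contradiction n<i (≤⇒≯ i≤n)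
... | no  _   = refl

cut-elim : {A : Set} (P : A → Set) {i n : ℕ} {x y : A} → P x → P y → P (cut i x y n)
cut-elim P {i} {n} px py with n <? i
... | yes _ = px
... | no  _ = py

module CombinatorialLines {X : Set} (xs : List X) (∈-xs : ∀ x → x ∈ xs) where

  _[_] : {n : ℕ} → Vec (Maybe X) n → X → Vec X n
  v [ a ] = Vec.map (fromMaybe a) v

  MonochromaticLine : (B : List X) {C : Set} {n : ℕ} → (Vec X n → C) → Set
  MonochromaticLine B {n = n} χ = Σ (Vec (Maybe X) n) λ v → nothing ∈ᵥ v ×
    (∀ {a a'} → a ∈ B → a' ∈ B → χ (v [ a ]) ≡ χ (v [ a' ]))

  HalesJewett : List X → Set₁
  HalesJewett B = {C : Set} (cs : List C) →
    ∃ λ n → (χ : Vec X n → C) → (∀ u → χ u ∈ cs) → MonochromaticLine B χ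

  _⟨_⟩ : {t n : ℕ} → Vec (X ⊎ Fin t) n → (Fin t → X) → Vec X n
  w ⟨ σ ⟩ = Vec.map [ id , σ ]′ w

  ⟨⟩-++ : {t m n : ℕ} (v : Vec (Maybe X) m) (w : Vec (X ⊎ Fin t) n) (σ : Fin (suc t) → X) →
    (Vec.map (maybe inj₁ (inj₂ zero)) v ++ Vec.map (Sum.map₂ suc) w) ⟨ σ ⟩
      ≡ v [ σ zero ] ++ w ⟨ σ ∘ suc ⟩
  ⟨⟩-++ v w σ = begin
    Vec.map [ id , σ ]′ (Vec.map (maybe inj₁ (inj₂ zero)) v ++ Vec.map (Sum.map₂ suc) w)
      ≡⟨ Vec.map-++ [ id , σ ]′ (Vec.map _ v) (Vec.map _ w) ⟩
    Vec.map [ id , σ ]′ (Vec.map (maybe inj₁ (inj₂ zero)) v) ++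
    Vec.map [ id , σ ]′ (Vec.map (Sum.map₂ suc) w)
      ≡⟨ cong₂ _++_ (Vec.map-∘ _ _ v) (Vec.map-∘ _ _ w) ⟨
    Vec.map ([ id , σ ]′ ∘ maybe inj₁ (inj₂ zero)) v ++ Vec.map ([ id , σ ]′ ∘ Sum.map₂ suc) w
      ≡⟨ cong₂ _++_ (Vec.map-cong lift-case v) (Vec.map-cong shift-case w) ⟩
    v [ σ zero ] ++ w ⟨ σ ∘ suc ⟩
      ∎
    where
    lift-case : (x : Maybe X) → [ id , σ ]′ (maybe inj₁ (inj₂ zero) x) ≡ fromMaybe (σ zero) x
    lift-case (just _) = refl
    lift-case nothing  = refl
    shift-case : (x : X ⊎ Fin _) → [ id , σ ]′ (Sum.map₂ suc x) ≡ [ id , σ ∘ suc ]′ x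
    shift-case (inj₁ _) = refl
    shift-case (inj₂ _) = refl

  Steps : X → List X → {t : ℕ} → ℕ → (Fin t → X) → Set
  Steps b B i σ = (∀ j → toℕ j < i → σ j ≡ b) × (∀ j → i ≤ toℕ j → σ j ∈ B)

  Steps-tail : ∀ {b B t i} {σ : Fin (suc t) → X} → Steps b B i σ → Steps b B (pred i) (σ ∘ suc)
  Steps-tail {i = zero}  (_ , above) = (λ _ ()) , (λ j _ → above (suc j) z≤n)
  Steps-tail {i = suc i} (below , above) =
    (λ j j<i → below (suc j) (s≤s j<i)) , (λ j i≤j → above (suc j) (s≤s i≤j))

  table : {C : Set} {m n : ℕ} → (Vec X (m + n) → C) → Vec X n → Vec C (length (vectors m xs))
  table {m = m} χ y = Vec.tabulate λ k → χ (List.lookup (vectors m xs) k ++ y)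

  table-∈ : {C : Set} {cs : List C} {m n : ℕ} (χ : Vec X (m + n) → C) → (∀ u → χ u ∈ cs) →
    ∀ y → table {m = m} χ y ∈ vectors _ cs
  table-∈ χ χ∈cs y = ∈-vectors (VecAll.tabulate⁺ λ _ → χ∈cs _)

  table-≡ : {C : Set} {m n : ℕ} (χ : Vec X (m + n) → C) {y y' : Vec X n} →
    table {m = m} χ y ≡ table χ y' → ∀ u → χ (u ++ y) ≡ χ (u ++ y')
  table-≡ {m = m} χ {y} {y'} same u = begin
    χ (u ++ y)                          ≡⟨ cong (λ u' → χ (u' ++ y)) u≡ ⟩
    χ (List.lookup (vectors m xs) k ++ y)  ≡⟨ Vec.lookup∘tabulate _ k ⟨
    Vec.lookup (table χ y) k            ≡⟨ cong (λ t → Vec.lookup t k) same ⟩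
    Vec.lookup (table χ y') k           ≡⟨ Vec.lookup∘tabulate _ k ⟩
    χ (List.lookup (vectors m xs) k ++ y') ≡⟨ cong (λ u' → χ (u' ++ y')) u≡ ⟨
    χ (u ++ y')                         ∎
    where
    u∈ = ∈-vectors (VecAll.universal ∈-xs u)
    k = Any.index u∈
    u≡ = lookup-index u∈

  FocusingWord : (b : X) (B : List X) (t : ℕ) {C : Set} {n : ℕ} → (Vec X n → C) → Set
  FocusingWord b B t {n = n} χ = Σ (Vec (X ⊎ Fin t) n) λ w → (∀ j → inj₂ j ∈ᵥ w) ×
    (∀ i {σ σ'} → Steps b B i σ → Steps b B i σ' → χ (w ⟨ σ ⟩) ≡ χ (w ⟨ σ' ⟩))

  Focusing : X → List X → ℕ → Set₁
  Focusing b B t = {C : Set} (cs : List C) →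
    ∃ λ n → (χ : Vec X n → C) → (∀ u → χ u ∈ cs) → FocusingWord b B t χ

  -- The new variable occupies a first block given by HJ(B); the other t variables a second
  -- block, focusing for the colouring of suffixes by the table of colours of all prefixes.
  focusing-suc : ∀ {b a₀ B t} → a₀ ∈ B → HalesJewett B → Focusing b B t → Focusing b B (suc t)
  focusing-suc {b} {a₀} {B} {t} a₀∈B hj focus {C} cs = n₁ + n₂ , focused
    where
    n₁ = proj₁ (hj cs)
    n₂ = proj₁ (focus (vectors (length (vectors n₁ xs)) cs))
    focused : (χ : Vec X (n₁ + n₂) → C) → (∀ u → χ u ∈ cs) → FocusingWord b B (suc t) χ
    focused χ χ∈cs with proj₂ (focus _) (table χ) (table-∈ χ χ∈cs)
    ... | w , occurs , focused-w with proj₂ (hj cs) (λ u → χ (u ++ w ⟨ const a₀ ⟩)) (λ _ → χ∈cs _)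
    ... | v , star , mono = w⁺ , occurs⁺ , focused⁺
      where
      w⁺ = Vec.map (maybe inj₁ (inj₂ zero)) v ++ Vec.map (Sum.map₂ suc) w
      occurs⁺ : ∀ j → inj₂ j ∈ᵥ w⁺
      occurs⁺ zero    = ∈-++⁺ˡ (∈-map⁺ _ star)
      occurs⁺ (suc j) = ∈-++⁺ʳ _ (∈-map⁺ _ (occurs j))
      suffix : ∀ {i} {σ σ' : Fin t → X} → Steps b B i σ → Steps b B i σ' →
        ∀ u → χ (u ++ w ⟨ σ ⟩) ≡ χ (u ++ w ⟨ σ' ⟩)
      suffix s s' = table-≡ χ (focused-w _ s s')
      all-a₀ : Steps b B 0 (const a₀)
      all-a₀ = (λ _ ()) , (λ _ _ → a₀∈B)
      bottom : ∀ {σ} → Steps b B 0 σ → χ (w⁺ ⟨ σ ⟩) ≡ χ (v [ a₀ ] ++ w ⟨ const a₀ ⟩)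
      bottom {σ} s = begin
        χ (w⁺ ⟨ σ ⟩)                       ≡⟨ cong χ (⟨⟩-++ v w σ) ⟩
        χ (v [ σ zero ] ++ w ⟨ σ ∘ suc ⟩)   ≡⟨ suffix (Steps-tail s) all-a₀ _ ⟩
        χ (v [ σ zero ] ++ w ⟨ const a₀ ⟩)  ≡⟨ mono (proj₂ s zero z≤n) a₀∈B ⟩
        χ (v [ a₀ ] ++ w ⟨ const a₀ ⟩)      ∎
      focused⁺ : ∀ i {σ σ'} → Steps b B i σ → Steps b B i σ' →
        χ (w⁺ ⟨ σ ⟩) ≡ χ (w⁺ ⟨ σ' ⟩)
      focused⁺ zero    s s' = trans (bottom s) (sym (bottom s'))
      focused⁺ (suc i) {σ} {σ'} s s' = begin
        χ (w⁺ ⟨ σ ⟩)                        ≡⟨ cong χ (⟨⟩-++ v w σ) ⟩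
        χ (v [ σ zero ] ++ w ⟨ σ ∘ suc ⟩)    ≡⟨ cong (λ a → χ (v [ a ] ++ w ⟨ σ ∘ suc ⟩)) σ₀≡σ'₀ ⟩
        χ (v [ σ' zero ] ++ w ⟨ σ ∘ suc ⟩)   ≡⟨ suffix (Steps-tail s) (Steps-tail s') _ ⟩
        χ (v [ σ' zero ] ++ w ⟨ σ' ∘ suc ⟩)  ≡⟨ cong χ (⟨⟩-++ v w σ') ⟨
        χ (w⁺ ⟨ σ' ⟩)                       ∎
        where
        σ₀≡σ'₀ = trans (proj₁ s zero (s≤s z≤n)) (sym (proj₁ s' zero (s≤s z≤n)))

  focusing : ∀ {b a₀ B} → a₀ ∈ B → HalesJewett B → ∀ t → Focusing b B t
  focusing a₀∈B hj zero    cs = 0 , λ _ _ → [] , (λ ()) , (λ _ _ _ → refl)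
  focusing a₀∈B hj (suc t) = focusing-suc a₀∈B hj (focusing a₀∈B hj t)

  stair : X → X → {t : ℕ} → ℕ → Fin t → X
  stair b a₀ i j = cut i b a₀ (toℕ j)

  stair-steps : ∀ {b a₀ B t} → a₀ ∈ B → ∀ i → Steps b B i (stair b a₀ {t} i)
  stair-steps a₀∈B i = (λ _ j<i → cut-< j<i) , (λ _ i≤j → subst (_∈ _) (sym (cut-≥ i≤j)) a₀∈B)

  lineBetween : X → X → {t : ℕ} → ℕ → ℕ → Fin t → Maybe X
  lineBetween b a₀ i i' j = cut i (just b) (cut i' nothing (just a₀) (toℕ j)) (toℕ j)

  lineBetween-star : ∀ {b a₀ t i i'} {j : Fin t} → i ≤ toℕ j → toℕ j < i' →
    lineBetween b a₀ i i' j ≡ nothing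
  lineBetween-star i≤j j<i' = trans (cut-≥ i≤j) (cut-< j<i')

  lineBetween-steps-b : ∀ {b a₀ B t i i'} → i < i' → a₀ ∈ B →
    Steps b B i' (fromMaybe b ∘ lineBetween b a₀ {t} i i')
  lineBetween-steps-b {b} {a₀} {B} {t} {i} {i'} i<i' a₀∈B = below , above
    where
    below : ∀ j → toℕ j < i' → fromMaybe b (lineBetween b a₀ i i' j) ≡ b
    below j j<i' = cut-elim (λ x → fromMaybe b x ≡ b) {i} {toℕ j} refl (cong (fromMaybe b) (cut-< j<i'))
    above : ∀ j → i' ≤ toℕ j → fromMaybe b (lineBetween b a₀ i i' j) ∈ B
    above j i'≤j = subst (λ x → fromMaybe b x ∈ B) (sym (trans (cut-≥ i≤j) (cut-≥ i'≤j))) a₀∈B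
      where
      i≤j = ≤-trans (<⇒≤ i<i') i'≤j

  lineBetween-steps : ∀ {b a₀ a B t i i'} → a ∈ B → a₀ ∈ B →
    Steps b B i (fromMaybe a ∘ lineBetween b a₀ {t} i i')
  lineBetween-steps {b} {a₀} {a} {B} {t} {i} {i'} a∈B a₀∈B =
    (λ _ j<i → cong (fromMaybe a) (cut-< j<i)) , above
    where
    above : ∀ j → i ≤ toℕ j → fromMaybe a (lineBetween b a₀ i i' j) ∈ B
    above j i≤j = subst (λ x → fromMaybe a x ∈ B) (sym (cut-≥ i≤j))
      (cut-elim (λ x → fromMaybe a x ∈ B) {i'} {toℕ j} a∈B a₀∈B)

  ⟨⟩-[] : {t n : ℕ} (w : Vec (X ⊎ Fin t) n) (ρ : Fin t → Maybe X) (a : X) →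
    Vec.map [ just , ρ ]′ w [ a ] ≡ w ⟨ fromMaybe a ∘ ρ ⟩
  ⟨⟩-[] {t} w ρ a = trans (sym (Vec.map-∘ _ _ w)) (Vec.map-cong fill w)
    where
    fill : (x : X ⊎ Fin t) → fromMaybe a ([ just , ρ ]′ x) ≡ [ id , fromMaybe a ∘ ρ ]′ x
    fill (inj₁ _) = refl
    fill (inj₂ _) = refl

  halesJewett-∷ : ∀ {b a₀ B} → a₀ ∈ B → HalesJewett B → HalesJewett (b ∷ B)
  halesJewett-∷ {b} {a₀} {B} a₀∈B hj {C} cs = n , line
    where
    t = length cs
    n = proj₁ (focusing {b} a₀∈B hj t cs)
    -- Among the t + 1 stairs two get the same colour, say at steps i < i'; the line has its
    -- variables on the steps in [i , i'), and each of its points is a stair up to recolouring.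
    line : (χ : Vec X n → C) → (∀ u → χ u ∈ cs) → MonochromaticLine (b ∷ B) χ
    line χ χ∈cs with proj₂ (focusing a₀∈B hj t cs) χ χ∈cs
    ... | w , occurs , focused
      with ∈-pigeonhole cs (λ k → χ (w ⟨ stair b a₀ (toℕ k) ⟩)) (λ _ → χ∈cs _)
    ... | k , k' , i<i' , same-colour = v , star , mono
      where
      i = toℕ k
      i' = toℕ k'
      v = Vec.map [ just , lineBetween b a₀ i i' ]′ w
      recolour : ∀ {a} → a ∈ b ∷ B → χ (v [ a ]) ≡ χ (w ⟨ stair b a₀ i' ⟩)
      recolour (here refl) = trans (cong χ (⟨⟩-[] w _ b))
        (focused i' (lineBetween-steps-b i<i' a₀∈B) (stair-steps a₀∈B i'))
      recolour {a} (there a∈B) = begin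
        χ (v [ a ])
          ≡⟨ cong χ (⟨⟩-[] w _ a) ⟩
        χ (w ⟨ fromMaybe a ∘ lineBetween b a₀ i i' ⟩)
          ≡⟨ focused i (lineBetween-steps a∈B a₀∈B) (stair-steps a₀∈B i) ⟩
        χ (w ⟨ stair b a₀ i ⟩)
          ≡⟨ same-colour ⟩
        χ (w ⟨ stair b a₀ i' ⟩)
          ∎
      mono : ∀ {a a'} → a ∈ b ∷ B → a' ∈ b ∷ B → χ (v [ a ]) ≡ χ (v [ a' ])
      mono a∈ a'∈ = trans (recolour a∈) (sym (recolour a'∈))
      i<t = <-≤-trans i<i' (toℕ≤pred[n] k')
      j₀≡i = toℕ-fromℕ< i<t
      star : nothing ∈ᵥ v
      star = subst (_∈ᵥ v) (lineBetween-star (≤-reflexive (sym j₀≡i)) (subst (_< i') (sym j₀≡i) i<i'))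
        (∈-map⁺ _ (occurs (fromℕ< i<t)))

  halesJewett : ∀ B → HalesJewett B
  halesJewett []          cs = 1 , λ _ _ → nothing ∷ [] , here refl , λ ()
  halesJewett (b ∷ [])    cs = 1 , λ _ _ → nothing ∷ [] , here refl , λ { (here refl) (here refl) → refl }
  halesJewett (b ∷ a ∷ B) = halesJewett-∷ (here refl) (halesJewett (a ∷ B))

place : {B : Set} {n : ℕ} → ℕ → Vec B n → Located B
place s []      = []
place s (x ∷ u) = (s , x) ∷ place (suc s) u

place-increasing : {B : Set} {n : ℕ} (s : ℕ) (u : Vec B n) → Increasing (place s u)
place-increasing s []          = []
place-increasing s (x ∷ [])    = [-]
place-increasing s (x ∷ y ∷ u) = n<1+n s ∷ place-increasing (suc s) (y ∷ u)

place-≥ : {B : Set} {n s' : ℕ} (s : ℕ) → s' ≤ s → (u : Vec B n) → InRangeInf s' (place s u)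
place-≥ s s'≤s []      = []
place-≥ s s'≤s (x ∷ u) = s'≤s ∷ place-≥ (suc s) (m≤n⇒m≤1+n s'≤s) u

map₂-place : {B B' : Set} {n : ℕ} (g : B → B') (s : ℕ) (u : Vec B n) →
  List.map (map₂ g) (place s u) ≡ place s (Vec.map g u)
map₂-place g s []      = refl
map₂-place g s (x ∷ u) = cong ((s , g x) ∷_) (map₂-place g (suc s) u)

place-hasStar : {k n : ℕ} (s : ℕ) {v : Vec (Maybe (Fin k)) n} → nothing ∈ᵥ v → HasStar (place s v)
place-hasStar s {_ ∷ _} (here refl) = here refl
place-hasStar s {_ ∷ _} (there star) = there (place-hasStar (suc s) star)

increasing-∷⇒> : {B : Set} {x : ℕ × B} {q : Located B} → Increasing (x ∷ q) →
  All (λ y → proj₁ x < proj₁ y) q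
increasing-∷⇒> [-]         = []
increasing-∷⇒> (x<y ∷ inc) = x<y ∷ All.map (<-trans x<y) (increasing-∷⇒> inc)

increasing-tail : {B : Set} {x : ℕ × B} {q : Located B} → Increasing (x ∷ q) → Increasing q
increasing-tail [-]       = []
increasing-tail (_ ∷ inc) = inc

++-increasing : {B : Set} {m : ℕ} (p r : Located B) → Increasing p → All (λ x → proj₁ x < m) p →
  Increasing r → InRangeInf m r → Increasing (p List.++ r)
++-increasing []           r       _              _          inc-r _         = inc-r
++-increasing (x ∷ [])     []      _              _          _     _         = [-]
++-increasing (x ∷ [])     (y ∷ r) _              (x<m ∷ []) inc-r (m≤y ∷ _) =
  <-≤-trans x<m m≤y ∷ inc-r
++-increasing (x ∷ x' ∷ p) r       (x<x' ∷ inc-p) (_ ∷ p<m)  inc-r r≥m       =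
  x<x' ∷ ++-increasing (x' ∷ p) r inc-p p<m inc-r r≥m

wordsIn : {B : Set} → List B → ℕ → ℕ → List (Located B)
wordsIn bs s zero    = [] ∷ []
wordsIn bs s (suc d) = wordsIn bs (suc s) d List.++
  cartesianProductWith (λ x q → (s , x) ∷ q) bs (wordsIn bs (suc s) d)

[]∈wordsIn : {B : Set} (bs : List B) (s d : ℕ) → [] ∈ wordsIn bs s d
[]∈wordsIn bs s zero    = here refl
[]∈wordsIn bs s (suc d) = Any.++⁺ˡ ([]∈wordsIn bs (suc s) d)

narrow : {B : Set} {s d : ℕ} {q : Located B} → All (λ y → s < proj₁ y) q →
  InRange s (s + suc d) q → InRange (suc s) (suc s + d) q
narrow []            []                = []
narrow {s = s} {d} (s<y ∷ above) ((_ , y<) ∷ range) =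
  (s<y , ≤-trans y< (≤-reflexive (+-suc s d))) ∷ narrow above range

∈-wordsIn : {B : Set} {bs : List B} → (∀ x → x ∈ bs) → ∀ d s {q : Located B} →
  Increasing q → InRange s (s + d) q → q ∈ wordsIn bs s d
∈-wordsIn {bs = bs} ∈-bs d s {[]} _ _ = []∈wordsIn bs s d
∈-wordsIn ∈-bs zero s {(p , _) ∷ _} _ ((s≤p , p<s+0) ∷ _) =
  ⊥-elim (≤⇒≯ s≤p (subst (p <_) (+-identityʳ s) p<s+0))
∈-wordsIn {bs = bs} ∈-bs (suc d) s {(p , x) ∷ q} inc range@((s≤p , _) ∷ q-range) with p ≟ s
... | yes refl = Any.++⁺ʳ (wordsIn bs (suc s) d) (∈-cartesianProductWith⁺ _ (∈-bs x)
      (∈-wordsIn ∈-bs d (suc s) (increasing-tail inc) (narrow (increasing-∷⇒> inc) q-range)))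
... | no  p≢s = Any.++⁺ˡ (∈-wordsIn ∈-bs d (suc s) inc
      (narrow (s<p ∷ All.map (<-trans s<p) (increasing-∷⇒> inc)) range))
  where
  s<p = ≤∧≢⇒< s≤p (p≢s ∘ sym)

toVarWord : {k : ℕ} → Word k → VarWord k
toVarWord = List.map (map₂ just)

subst⋆-toVarWord : {k : ℕ} (q : Word k) (a : Fin k) → subst⋆ (toVarWord q) a ≡ q
subst⋆-toVarWord q a = trans (sym (List.map-∘ q)) (List.map-id q)

subst⋆-++-place : {k n : ℕ} (q : Word k) (m : ℕ) (v : Vec (Maybe (Fin k)) n) (a : Fin k) →
  subst⋆ (toVarWord q List.++ place m v) a ≡ q List.++ place m (Vec.map (fromMaybe a) v)
subst⋆-++-place {k} q m v a = begin
  subst⋆ (toVarWord q List.++ place m v) a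
    ≡⟨ List.map-++ _ (toVarWord q) (place m v) ⟩
  subst⋆ (toVarWord q) a List.++ List.map (map₂ (fillLetter a)) (place m v)
    ≡⟨ cong₂ List._++_ (subst⋆-toVarWord q a) (map₂-place (fillLetter a) m v) ⟩
  q List.++ place m (Vec.map (fillLetter a) v)
    ≡⟨ cong (λ u → q List.++ place m u) (Vec.map-cong fillLetter≗fromMaybe v) ⟩
  q List.++ place m (Vec.map (fromMaybe a) v)
    ∎
  where
  fillLetter≗fromMaybe : (x : Maybe (Fin k)) → fillLetter a x ≡ fromMaybe a x
  fillLetter≗fromMaybe (just _) = refl
  fillLetter≗fromMaybe nothing  = refl

module _ {k c : ℕ} (f : Word (suc k) → Fin c) {ℓ m : ℕ} (ℓ<m : ℓ < m)
  (return : (p : Word (suc k)) → Increasing p → InRangeInf m p →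
    Σ (Word (suc k)) λ q → Increasing q × InRange ℓ m q × SameShift f ℓ (q List.++ p)) where

  open CombinatorialLines (allFin (suc k)) ∈-allFin

  returnWords : List (Word (suc k))
  returnWords = wordsIn (allFin (suc k)) 0 m

  lineLength : ℕ
  lineLength = proj₁ (halesJewett (allFin (suc k)) returnWords)

  returnTo : (u : Vec (Fin (suc k)) lineLength) →
    Σ (Word (suc k)) λ q → Increasing q × InRange ℓ m q × SameShift f ℓ (q List.++ place m u)
  returnTo u = return (place m u) (place-increasing m u) (place-≥ m ≤-refl u)

  returnTo-∈ : ∀ u → proj₁ (returnTo u) ∈ returnWords
  returnTo-∈ u with returnTo u
  ... | q , q-increasing , q-range , _ =
    ∈-wordsIn ∈-allFin m 0 q-increasing (All.map (λ (_ , q<m) → z≤n , q<m) q-range)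

  recurrent-at : Σ (VarWord (suc k)) λ p → Increasing p × HasStar p × InRangeInf ℓ p ×
    ((a : Fin (suc k)) → SameShift f ℓ (subst⋆ p a))
  recurrent-at with proj₂ (halesJewett (allFin (suc k)) returnWords) (proj₁ ∘ returnTo) returnTo-∈
  ... | v , star , mono = toVarWord q List.++ place m v , increasing , hasStar , inRange , sameShift
    where
    q = proj₁ (returnTo (v [ zero ]))
    q-increasing = proj₁ (proj₂ (returnTo (v [ zero ])))
    q-range = proj₁ (proj₂ (proj₂ (returnTo (v [ zero ]))))
    increasing = ++-increasing (toVarWord q) (place m v) (Linked.map⁺ q-increasing)
      (All.map⁺ (All.map proj₂ q-range)) (place-increasing m v) (place-≥ m ≤-refl v)
    hasStar = Any.++⁺ʳ (toVarWord q) (place-hasStar m star)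
    inRange = All.++⁺ (All.map⁺ (All.map proj₁ q-range)) (place-≥ m (<⇒≤ ℓ<m) v)
    sameShift : (a : Fin (suc k)) → SameShift f ℓ (subst⋆ (toVarWord q List.++ place m v) a)
    sameShift a = subst (SameShift f ℓ) (sym (begin
      subst⋆ (toVarWord q List.++ place m v) a
        ≡⟨ subst⋆-++-place q m v a ⟩
      q List.++ place m (v [ a ])
        ≡⟨ cong (List._++ place m (v [ a ])) (mono (∈-allFin zero) (∈-allFin a)) ⟩
      proj₁ (returnTo (v [ a ])) List.++ place m (v [ a ])
        ∎))
      (proj₂ (proj₂ (proj₂ (returnTo (v [ a ])))))

lemma4p2 : (k c : ℕ) → (f : Word (suc k) → Fin (suc c)) →
    UniformlyRecurrent f → Recurrent f
lemma4p2 k c f ur ℓ = recurrent-at f (proj₁ (proj₂ (ur ℓ))) (proj₂ (proj₂ (ur ℓ)))
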